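{- Let $s \geq 1$ be an integer. A partition into distinct parts is both $s$-core and $(s+1)$-core if and only if its perimeter is strictly less than $s$.
   Context: A partition $\lambda = (\lambda_1, \ldots, \lambda_\ell)$ is a finite weakly decreasing sequence of positive integers (the empty partition is allowed); it has distinct parts if $\lambda_1 > \cdots > \lambda_\ell$. In its Young diagram (left-justified rows of $\lambda_i$ cells), the hook length of a cell $u$ is the number of cells consisting of $u$, the cells to its right in its row, and the cells below it in its column. $\lambda$ is $t$-core if no cell has hook length $t$. The perimeter of a nonempty partition is $\lambda_1 + \ell - 1$, which equals the maximum hook length of its cells; the empty partition has perimeter $0$. -}

module Defs where

open import Data.Nat using (ℕ; zero; suc; _+_; _∸_; _<_; _>_; _≥_; _<?_)
open import Data.List using (List; []; _∷_; length; filter; lookup)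
open import Data.List.Relation.Unary.All using (All)
open import Data.List.Relation.Unary.Linked using (Linked)
open import Data.Fin using (Fin; toℕ)
open import Data.Product using (Σ; _×_; _,_)
open import Relation.Binary.PropositionalEquality using (_≡_)
open import Relation.Nullary using (¬_)

IsPartition : List ℕ → Set
IsPartition λs = All (λ p → 0 < p) λs × Linked _≥_ λs

HasDistinctParts : List ℕ → Set
HasDistinctParts λs = Linked _>_ λs

-- Conjugate part λ'_{j+1} (0-indexed column j): number of parts > j,
-- i.e. the length of column j of the Young diagram.
conj : List ℕ → ℕ → ℕ
conj λs j = length (filter (j <?_) λs)

Cell : List ℕ → Set
Cell λs = Σ (Fin (length λs)) (λ i → Fin (lookup λs i))

-- Hook length of cell (i,j): the cell itself, (λ_i - j - 1) cells to its right,
-- and (λ'_j - i - 1) cells below it.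
hook : (λs : List ℕ) → Cell λs → ℕ
hook λs (i , j) =
  1 + (lookup λs i ∸ suc (toℕ j)) + (conj λs (toℕ j) ∸ suc (toℕ i))

IsCore : ℕ → List ℕ → Set
IsCore t λs = ¬ (Σ (Cell λs) (λ c → hook λs c ≡ t))

perimeter : List ℕ → ℕ
perimeter [] = 0
perimeter λs@(p ∷ _) = p + length λs ∸ 1

-- Every hook of a partition is at most its perimeter, which settles one direction.
-- Conversely, along the first row of a partition with distinct parts the hook lengths
-- run from the perimeter down to 1, and consecutive ones differ by at most 2, since
-- adjacent columns differ in length by at most one.  So a perimeter ≥ s forces a
-- first-row hook equal to s or s + 1.
module Submission where

open import Defs
open import Data.Nat using (ℕ; zero; suc; _+_; _∸_; _≤_; _<_; _≥_; _>_; _<?_; z≤n; s≤s)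
open import Data.Nat.Properties
open import Data.List using (List; []; _∷_; length; lookup)
open import Data.List.Properties using (length-filter; filter-accept; filter-reject; filter-all; filter-none)
open import Data.List.Relation.Unary.All as All using (All; []; _∷_)
open import Data.List.Relation.Unary.Linked as Linked using (Linked; []; [-]; _∷_)
open import Data.Maybe.Relation.Binary.Connected using (just)
open import Data.Fin using (Fin; toℕ; fromℕ<)
open import Data.Fin.Properties using (toℕ<n; toℕ-fromℕ<)
open import Data.Product using (∃-syntax; _×_; _,_)
open import Data.Sum as Sum using (_⊎_; inj₁; inj₂)
open import Function.Bundles using (_⇔_; mk⇔)
open import Relation.Nullary using (¬_; yes; no; contradiction)
open import Relation.Binary.PropositionalEquality using (_≡_; sym; trans; cong)

private
  variable
    j p s t : ℕ
    ps : List ℕ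

suc[m∸1+n]≡m∸n : ∀ {m n} → n < m → suc (m ∸ suc n) ≡ m ∸ n
suc[m∸1+n]≡m∸n n<m = sym (+-∸-assoc 1 n<m)

parts-below-head : Linked _>_ (p ∷ ps) → All (_< p) ps
parts-below-head [-] = []
parts-below-head (p>q ∷ l) = p>q ∷ All.map (λ r<q → <-trans r<q p>q) (parts-below-head l)

part≤head : Linked _≥_ (p ∷ ps) → (i : Fin (suc (length ps))) → lookup (p ∷ ps) i ≤ p
part≤head lin = Linked.lookup (λ p≥q q≥r → ≤-trans q≥r p≥q) lin (just ≤-refl)

conj-accept : ∀ ps → j < p → conj (p ∷ ps) j ≡ suc (conj ps j)
conj-accept {j} ps j<p = cong length (filter-accept (j <?_) {xs = ps} j<p)

conj-reject : ∀ ps → ¬ j < p → conj (p ∷ ps) j ≡ conj ps j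
conj-reject {j} ps j≮p = cong length (filter-reject (j <?_) {xs = ps} j≮p)

conj≤length : ∀ ps j → conj ps j ≤ length ps
conj≤length ps j = length-filter (j <?_) ps

conj-zero≡length : All (0 <_) ps → conj ps 0 ≡ length ps
conj-zero≡length pos = cong length (filter-all (0 <?_) pos)

conj≡0 : All (_≤ j) ps → conj ps j ≡ 0
conj≡0 {j} small = cong length (filter-none (j <?_) (All.map ≤⇒≯ small))

-- With distinct parts at most one part equals j + 1.
conj≤1+conj-suc : Linked _>_ ps → conj ps j ≤ suc (conj ps (suc j))
conj≤1+conj-suc {[]} _ = z≤n
conj≤1+conj-suc {p ∷ ps} {j} dist with j <? p | suc j <? p
... | yes j<p | yes 1+j<p
  rewrite conj-accept ps j<p | conj-accept ps 1+j<p = s≤s (conj≤1+conj-suc (Linked.tail dist))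
... | yes j<p | no 1+j≮p
  rewrite conj-accept ps j<p
        | conj≡0 (All.map (λ q<p → ≤-pred (≤-trans q<p (≮⇒≥ 1+j≮p))) (parts-below-head dist))
  = s≤s z≤n
... | no j≮p | yes 1+j<p = contradiction (<-trans (n<1+n j) 1+j<p) j≮p
... | no j≮p | no 1+j≮p
  rewrite conj-reject ps j≮p | conj-reject ps 1+j≮p = conj≤1+conj-suc (Linked.tail dist)

perimeter-∷ : ∀ p ps → perimeter (p ∷ ps) ≡ p + length ps
perimeter-∷ p ps = cong (_∸ 1) (+-suc p (length ps))

hook≤perimeter : ∀ {λs} → Linked _≥_ λs → (c : Cell λs) → hook λs c ≤ perimeter λs
hook≤perimeter {p ∷ ps} lin (i , j) rewrite perimeter-∷ p ps =
  +-mono-≤ arm+1≤p leg≤length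
  where
  arm+1≤p : suc (lookup (p ∷ ps) i ∸ suc (toℕ j)) ≤ p
  arm+1≤p = begin
    suc (lookup (p ∷ ps) i ∸ suc (toℕ j)) ≡⟨ suc[m∸1+n]≡m∸n (toℕ<n j) ⟩
    lookup (p ∷ ps) i ∸ toℕ j              ≤⟨ m∸n≤m _ (toℕ j) ⟩
    lookup (p ∷ ps) i                      ≤⟨ part≤head lin i ⟩
    p                                      ∎
    where open ≤-Reasoning
  leg≤length : conj (p ∷ ps) (toℕ j) ∸ suc (toℕ i) ≤ length ps
  leg≤length = ≤-trans (∸-monoʳ-≤ (conj (p ∷ ps) (toℕ j)) (s≤s (z≤n {toℕ i})))
                       (∸-monoˡ-≤ 1 (conj≤length (p ∷ ps) (toℕ j)))

perimeter<t⇒core : ∀ {λs} → Linked _≥_ λs → perimeter λs < t → IsCore t λs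
perimeter<t⇒core lin per<t (c , hook≡t) = <-irrefl hook≡t (≤-<-trans (hook≤perimeter lin c) per<t)

slow-descent-hits : (g : ℕ → ℕ) (m : ℕ) → (∀ j → j < m → g j ≤ 2 + g (suc j)) →
               s ≤ g 0 → g m ≤ s → ∃[ j ] j ≤ m × (g j ≡ s ⊎ g j ≡ suc s)
slow-descent-hits {s} g m slow s≤g0 gm≤s with g 0 ≤? suc s
... | yes g0≤1+s with m≤n⇒m<n∨m≡n g0≤1+s
...   | inj₁ g0<1+s = 0 , z≤n , inj₁ (≤-antisym (≤-pred g0<1+s) s≤g0)
...   | inj₂ g0≡1+s = 0 , z≤n , inj₂ g0≡1+s
slow-descent-hits g zero slow s≤g0 gm≤s | no g0≰1+s = contradiction (m≤n⇒m≤1+n gm≤s) g0≰1+s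
slow-descent-hits {s} g (suc m) slow s≤g0 gm≤s | no g0≰1+s
  with slow-descent-hits (λ j → g (suc j)) m (λ j j<m → slow (suc j) (s≤s j<m)) s≤g1 gm≤s
  where
  s≤g1 : s ≤ g 1
  s≤g1 = ≤-pred (≤-pred (≤-trans (≰⇒> g0≰1+s) (slow 0 (s≤s z≤n))))
... | j , j≤m , hit = suc j , s≤s j≤m , hit

first-row-hook : ∀ ps → (j<p : j < p) → hook (p ∷ ps) (Fin.zero , fromℕ< j<p) ≡ p ∸ j + conj ps j
first-row-hook {j} ps j<p
  rewrite toℕ-fromℕ< j<p | conj-accept ps j<p = cong (_+ conj ps j) (suc[m∸1+n]≡m∸n j<p)

distinct⇒∃hook≡s⊎1+s : ∀ {λs} → IsPartition λs → HasDistinctParts λs →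
                       1 ≤ s → s ≤ perimeter λs →
                       ∃[ c ] (hook λs c ≡ s ⊎ hook λs c ≡ suc s)
distinct⇒∃hook≡s⊎1+s {λs = []} _ _ 1≤s s≤0 = contradiction (≤-trans 1≤s s≤0) λ ()
distinct⇒∃hook≡s⊎1+s {s} {suc q ∷ ps} (_ ∷ pos , _) dist 1≤s s≤per
  with slow-descent-hits g q slow (≤-trans s≤per (≤-reflexive (sym g0≡per)))
                                  (≤-trans (≤-reflexive gq≡1) 1≤s)
  where
  g : ℕ → ℕ
  g j = suc q ∸ j + conj ps j
  slow : ∀ j → j < q → g j ≤ 2 + g (suc j)
  slow j j<q = begin
    suc q ∸ j + conj ps j               ≡⟨ cong (_+ conj ps j) (+-∸-assoc 1 (<⇒≤ j<q)) ⟩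
    suc (q ∸ j + conj ps j)             ≤⟨ s≤s (+-monoʳ-≤ (q ∸ j) (conj≤1+conj-suc (Linked.tail dist))) ⟩
    suc (q ∸ j + suc (conj ps (suc j))) ≡⟨ cong suc (+-suc (q ∸ j) (conj ps (suc j))) ⟩
    2 + g (suc j)                       ∎
    where open ≤-Reasoning
  g0≡per : g 0 ≡ perimeter (suc q ∷ ps)
  g0≡per = trans (cong (suc q +_) (conj-zero≡length pos)) (sym (perimeter-∷ (suc q) ps))
  gq≡1 : g q ≡ 1
  gq≡1 rewrite m+n∸n≡m 1 q = cong suc (conj≡0 (All.map ≤-pred (parts-below-head dist)))
... | j , j≤q , hit = (Fin.zero , fromℕ< (s≤s j≤q)) , Sum.map (trans hook≡g) (trans hook≡g) hit
  where
  hook≡g : hook (suc q ∷ ps) (Fin.zero , fromℕ< (s≤s j≤q)) ≡ suc q ∸ j + conj ps j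
  hook≡g = first-row-hook ps (s≤s j≤q)

lemma9 : (s : ℕ) → 1 ≤ s → (λs : List ℕ) → IsPartition λs → HasDistinctParts λs →
         ((IsCore s λs × IsCore (suc s) λs) ⇔ (perimeter λs < s))
lemma9 s 1≤s λs part@(_ , weak) dist = mk⇔ to from
  where
  from : perimeter λs < s → IsCore s λs × IsCore (suc s) λs
  from per<s = perimeter<t⇒core weak per<s , perimeter<t⇒core weak (m<n⇒m<1+n per<s)

  to : IsCore s λs × IsCore (suc s) λs → perimeter λs < s
  to (s-core , 1+s-core) with perimeter λs <? s
  ... | yes per<s = per<s
  ... | no per≮s with distinct⇒∃hook≡s⊎1+s part dist 1≤s (≮⇒≥ per≮s)
  ...   | c , inj₁ hook≡s   = contradiction (c , hook≡s) s-core
  ...   | c , inj₂ hook≡1+s = contradiction (c , hook≡1+s) 1+s-core
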